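{- Let $n\ge2$, $k\ge1$ and let $R^n_k:[\omega]^n\to k$ be a function with the $(n,k)$-star property. Then for every $c:[\omega]^n\to k$ there exists an injective function $f:\omega\to\omega$ such that $c(\{a_1,\dots,a_n\})=R^n_k(\{f(a_1),\dots,f(a_n)\})$ for all distinct natural numbers $a_1,\dots,a_n$.
   Context: A function $R:[\omega]^n\to k$ has the $(n,k)$-star property if for every pairwise disjoint finite sets $A_0,\dots,A_{k-1}\subseteq[\omega]^{n-1}$ there exists $j\in\omega\setminus\bigcup_{i<k}\bigcup A_i$ such that for every $i<k$ and every $\{j_2,\dots,j_n\}\in A_i$, $R(\{j,j_2,\dots,j_n\})=i$. -}

module Defs where

open import Data.Nat using (ℕ; _<_; _∸_)
open import Data.Fin using (Fin)
open import Data.List using (List; length)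
open import Data.List.Membership.Propositional using (_∈_)
open import Data.List.Relation.Unary.AllPairs using (AllPairs)
open import Data.Product using (Σ; ∃; _×_)
open import Data.Sum using (_⊎_)
open import Relation.Binary.PropositionalEquality using (_≡_; _≢_)
open import Relation.Nullary using (¬_)
open import Function.Bundles using (_⇔_)

-- [ω]^n : the n-element subsets of ω = ℕ, represented canonically as
-- strictly increasing lists of length n.
record [ω]^ (n : ℕ) : Set where
  constructor mkSet
  field
    elems  : List ℕ
    sorted : AllPairs _<_ elems
    size   : length elems ≡ n
open [ω]^ public

_IsInsert_Into_ : ∀ {n m} → [ω]^ n → ℕ → [ω]^ m → Set
t IsInsert j Into s = ∀ x → (x ∈ elems t) ⇔ (x ≡ j ⊎ x ∈ elems s)

_IsImageOf_Under_ : ∀ {n m} → [ω]^ n → [ω]^ m → (ℕ → ℕ) → Set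
t IsImageOf s Under f = ∀ y → (y ∈ elems t) ⇔ (∃ λ x → x ∈ elems s × f x ≡ y)

PairwiseDisjoint : ∀ {m k} → (Fin k → List ([ω]^ m)) → Set
PairwiseDisjoint {m} {k} A =
  ∀ (i i' : Fin k) (s s' : [ω]^ m) → i ≢ i' → s ∈ A i → s' ∈ A i' →
  elems s ≢ elems s'

StarProperty : (n k : ℕ) → ([ω]^ n → Fin k) → Set
StarProperty n k R =
  ∀ (A : Fin k → List ([ω]^ (n ∸ 1))) → PairwiseDisjoint A →
  Σ ℕ λ j →
    (∀ i s → s ∈ A i → ¬ (j ∈ elems s)) ×
    (∀ i s → s ∈ A i → ∀ (t : [ω]^ n) → t IsInsert j Into s → R t ≡ i)

-- f is built increasing, one value at a time. Once f is fixed below m, colour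
-- each (n-1)-set u below a large enough bound by c (s ∪ {m}) if u = f[s] for
-- some s ⊆ {0, …, m-1}, and by 0 otherwise; f m is the point the star property
-- provides for these colour classes. Then R (f[s] ∪ {f m}) = c (s ∪ {m}), which
-- is the claim for every n-set with maximum m. Since the classes cover all
-- (n-1)-sets below the bound and f m avoids all of them, f m exceeds the earlier
-- values of f.
module Submission where

open import Defs
open import Data.Nat using (ℕ; _≤_)
open import Data.Fin using (Fin)
open import Data.Product using (Σ; _×_)
open import Relation.Binary.PropositionalEquality using (_≡_)
open import Function.Definitions using (Injective)

open import Data.Nat using (zero; suc; _+_; _<_; _⊔_; z≤n; s≤s; z<s; _<?_)
open import Data.Nat.Properties
open import Data.Fin using () renaming (zero to fzero; _≟_ to _≟ᶠ_)
open import Data.List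
  using (List; []; _∷_; _∷ʳ_; map; length; filter; upTo; applyUpTo; cartesianProductWith; mapMaybe; initLast; _∷ʳ′_)
open import Data.List.Properties using (≡-dec; length-map; map-injective; length-applyUpTo)
open import Data.List.Relation.Unary.All as All using (All; []; _∷_; all?)
import Data.List.Relation.Unary.All.Properties as All
open import Data.List.Relation.Unary.AllPairs as AllPairs using (AllPairs; []; _∷_; allPairs?)
import Data.List.Relation.Unary.AllPairs.Properties as AllPairs
open import Data.List.Relation.Unary.Any as Any using (here; any?)
import Data.List.Relation.Unary.Any.Properties as Any
open import Data.List.Membership.Propositional using (_∈_; lose)
open import Data.List.Membership.Propositional.Properties
  using (∈-map⁺; ∈-map⁻; ∈-++⁺ˡ; ∈-++⁺ʳ; ∈-++⁻; ∈-filter⁺; ∈-filter⁻; ∈-upTo⁺; ∈-cartesianProductWith⁺)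
open import Data.Maybe using (Maybe; just; nothing)
import Data.Maybe.Relation.Unary.Any as Maybe
open import Data.Product using (_,_; proj₁; proj₂; ∃)
open import Data.Sum using (_⊎_; inj₁; inj₂)
open import Data.Empty using (⊥-elim)
open import Relation.Binary.Core using (_Preserves_⟶_)
open import Relation.Binary.Definitions using (tri<; tri≈; tri>)
open import Relation.Nullary using (Dec; yes; no; ¬_)
open import Relation.Nullary.Decidable using (_×-dec_; map′)
open import Relation.Unary using (Decidable)
open import Relation.Binary.PropositionalEquality using (refl; sym; trans; cong; cong₂; subst; module ≡-Reasoning)
open import Function.Bundles using (mk⇔; Equivalence)

<-preserving⇒injective : ∀ {f : ℕ → ℕ} → f Preserves _<_ ⟶ _<_ → Injective _≡_ _≡_ f
<-preserving⇒injective mono {a} {b} fa≡fb with <-cmp a b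
... | tri< a<b _ _ = ⊥-elim (<⇒≢ (mono a<b) fa≡fb)
... | tri≈ _ a≡b _ = a≡b
... | tri> _ _ b<a = ⊥-elim (<⇒≢ (mono b<a) (sym fa≡fb))

length-∷ʳ : ∀ {A : Set} (xs : List A) x → length (xs ∷ʳ x) ≡ suc (length xs)
length-∷ʳ []       x = refl
length-∷ʳ (y ∷ xs) x = cong suc (length-∷ʳ xs x)

∷ʳ-sorted⁺ : ∀ {xs x} → AllPairs _<_ xs → All (_< x) xs → AllPairs _<_ (xs ∷ʳ x)
∷ʳ-sorted⁺ sorted below = AllPairs.++⁺ sorted ([] ∷ []) (All.map (_∷ []) below)

∷ʳ-sorted⁻ : ∀ xs {x} → AllPairs _<_ (xs ∷ʳ x) → AllPairs _<_ xs × All (_< x) xs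
∷ʳ-sorted⁻ []       _               = [] , []
∷ʳ-sorted⁻ (y ∷ xs) (y<xs∷ʳx ∷ rest) with All.∷ʳ⁻ y<xs∷ʳx | ∷ʳ-sorted⁻ xs rest
... | y<xs , y<x | sorted , below = y<xs ∷ sorted , y<x ∷ below

module _ {r : ℕ} where

  elems-injective : {s s' : [ω]^ r} → elems s ≡ elems s' → s ≡ s'
  elems-injective {mkSet xs p q} {mkSet .xs p' q'} refl =
    cong₂ (mkSet xs) (AllPairs.irrelevant <-irrelevant p p') (≡-irrelevant q q')

  Bounded : ℕ → [ω]^ r → Set
  Bounded N s = All (_< N) (elems s)

  Bounded-mono : ∀ {N N'} {s : [ω]^ r} → N ≤ N' → Bounded N s → Bounded N' s
  Bounded-mono N≤N' = All.map (λ x<N → <-≤-trans x<N N≤N')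

  addMax : (s : [ω]^ r) (m : ℕ) → Bounded m s → [ω]^ (suc r)
  addMax s m s<m = mkSet (elems s ∷ʳ m) (∷ʳ-sorted⁺ (sorted s) s<m)
                         (trans (length-∷ʳ (elems s) m) (cong suc (size s)))

  image : (f : ℕ → ℕ) → f Preserves _<_ ⟶ _<_ → [ω]^ r → [ω]^ r
  image f mono s = mkSet (map f (elems s)) (AllPairs.map⁺ (AllPairs.map mono (sorted s)))
                         (trans (length-map f (elems s)) (size s))

  image-addMax : ∀ {f} (mono : f Preserves _<_ ⟶ _<_) (s : [ω]^ r) m (s<m : Bounded m s)
                 (t : [ω]^ (suc r)) → t IsImageOf addMax s m s<m Under f →
                 t IsInsert f m Into image f mono s
  image-addMax {f} _ s m _ t img y = mk⇔ to from
    where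
    to : ∀ {y} → y ∈ elems t → y ≡ f m ⊎ y ∈ map f (elems s)
    to y∈t with Equivalence.to (img _) y∈t
    ... | x , x∈ , refl with ∈-++⁻ (elems s) x∈
    ...   | inj₁ x∈s        = inj₂ (∈-map⁺ f x∈s)
    ...   | inj₂ (here refl) = inj₁ refl
    from : ∀ {y} → y ≡ f m ⊎ y ∈ map f (elems s) → y ∈ elems t
    from (inj₁ refl) = Equivalence.from (img _) (m , ∈-++⁺ʳ (elems s) (here refl) , refl)
    from (inj₂ y∈) with ∈-map⁻ f y∈
    ... | x , x∈s , refl = Equivalence.from (img _) (x , ∈-++⁺ˡ x∈s , refl)

  colourClass : ∀ {k} → ([ω]^ r → Fin k) → List ([ω]^ r) → Fin k → List ([ω]^ r)
  colourClass χ L i = filter (λ u → χ u ≟ᶠ i) L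

  ∈-colourClass : ∀ {k} (χ : [ω]^ r → Fin k) {L u} → u ∈ L → u ∈ colourClass χ L (χ u)
  ∈-colourClass χ u∈L = ∈-filter⁺ (λ v → χ v ≟ᶠ _) u∈L refl

  colourClass-disjoint : ∀ {k} (χ : [ω]^ r → Fin k) L → PairwiseDisjoint (colourClass χ L)
  colourClass-disjoint χ L i i' s s' i≢i' s∈ s'∈ s≡s' =
    i≢i' (trans (sym (proj₂ (∈-filter⁻ (λ u → χ u ≟ᶠ i) {xs = L} s∈)))
         (trans (cong χ (elems-injective s≡s'))
                (proj₂ (∈-filter⁻ (λ u → χ u ≟ᶠ i') {xs = L} s'∈))))

splitMax : ∀ {r} (s : [ω]^ (suc r)) →
           ∃ λ (l : [ω]^ r) → ∃ λ m → Σ (Bounded m l) λ l<m → s ≡ addMax l m l<m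
splitMax (mkSet xs sorted size) with initLast xs
splitMax (mkSet .[]         _      ()) | []
splitMax (mkSet .(ys ∷ʳ y) sorted size) | ys ∷ʳ′ y =
  mkSet ys init-sorted (suc-injective (trans (sym (length-∷ʳ ys y)) size)) , y , below ,
  elems-injective refl
  where
  init-sorted = proj₁ (∷ʳ-sorted⁻ ys sorted)
  below = proj₂ (∷ʳ-sorted⁻ ys sorted)

lists : ℕ → ℕ → List (List ℕ)
lists zero    N = [] ∷ []
lists (suc r) N = cartesianProductWith _∷_ (upTo N) (lists r N)

∈-lists : ∀ {r N} xs → length xs ≡ r → All (_< N) xs → xs ∈ lists r N
∈-lists []       refl []            = here refl
∈-lists (x ∷ xs) refl (x<N ∷ xs<N) = ∈-cartesianProductWith⁺ _∷_ (∈-upTo⁺ x<N) (∈-lists xs refl xs<N)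

toSet : ∀ r → List ℕ → Maybe ([ω]^ r)
toSet r xs with allPairs? _<?_ xs | length xs ≟ r
... | yes sorted | yes size = just (mkSet xs sorted size)
... | _          | _        = nothing

toSet-elems : ∀ {r} (s : [ω]^ r) → toSet r (elems s) ≡ just s
toSet-elems {r} s with allPairs? _<?_ (elems s) | length (elems s) ≟ r
... | yes _ | yes _   = cong just (elems-injective refl)
... | yes _ | no ¬size = ⊥-elim (¬size (size s))
... | no ¬sorted | _  = ⊥-elim (¬sorted (sorted s))

subsetsBelow : ∀ r → ℕ → List ([ω]^ r)
subsetsBelow r N = mapMaybe (toSet r) (lists r N)

∈-subsetsBelow : ∀ {r N} {s : [ω]^ r} → Bounded N s → s ∈ subsetsBelow r N
∈-subsetsBelow {r} {N} {s} s<N =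
  Any.mapMaybe⁺ (toSet r) (lists r N) (Any.map⁺ (Any.map found (∈-lists (elems s) (size s) s<N)))
  where
  found : ∀ {xs} → elems s ≡ xs → Maybe.Any (s ≡_) (toSet r xs)
  found refl = subst (Maybe.Any (s ≡_)) (sym (toSet-elems s)) (Maybe.just refl)

∃-bounded? : ∀ {r} N {P : [ω]^ r → Set} → Decidable P → Dec (∃ λ s → Bounded N s × P s)
∃-bounded? {r} N P? =
  map′ Any.satisfied (λ (s , s<N , Ps) → lose (∈-subsetsBelow s<N) (s<N , Ps))
       (any? (λ s → all? (_<? N) (elems s) ×-dec P? s) (subsetsBelow r N))

interval : ℕ → (len : ℕ) → [ω]^ len
interval a len = mkSet (applyUpTo (a +_) len)
                       (AllPairs.applyUpTo⁺₁ _ len (λ i<j _ → +-monoʳ-< a i<j))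
                       (length-applyUpTo _ len)

interval-bounded : ∀ a len → Bounded (a + len) (interval a len)
interval-bounded a len = All.applyUpTo⁺₁ _ len (+-monoʳ-< a)

-- If j ≤ B, the interval {j, …, j + n'} is one of the covered sets.
avoiding-point-exceeds : ∀ {n' k} (A : Fin k → List ([ω]^ (suc n'))) {B j} →
  (∀ u → Bounded (B + suc n') u → ∃ λ i → u ∈ A i) →
  (∀ i s → s ∈ A i → ¬ (j ∈ elems s)) → B < j
avoiding-point-exceeds {n'} A {B} {j} covered avoids with B <? j
... | yes B<j = B<j
... | no B≮j with covered (interval j (suc n')) (Bounded-mono {s = interval j (suc n')}
                                                    (+-monoˡ-≤ (suc n') (≮⇒≥ B≮j))
                                                    (interval-bounded j (suc n')))
...   | i , ∈A = ⊥-elim (avoids i _ ∈A (here (sym (+-identityʳ j))))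

maxBelow : ℕ → (ℕ → ℕ) → ℕ
maxBelow zero    h = 0
maxBelow (suc m) h = maxBelow m h ⊔ h m

≤-maxBelow : ∀ {a m} (h : ℕ → ℕ) → a < m → h a ≤ maxBelow m h
≤-maxBelow {a} {suc m} h a<1+m with a ≟ m
... | yes refl = m≤n⊔m (maxBelow m h) (h m)
... | no a≢m   = ≤-trans (≤-maxBelow h (≤∧≢⇒< (≤-pred a<1+m) a≢m)) (m≤m⊔n _ _)

module Construction (n' k' : ℕ) (R : [ω]^ (suc (suc n')) → Fin (suc k'))
                    (star : StarProperty (suc (suc n')) (suc k') R)
                    (c : [ω]^ (suc (suc n')) → Fin (suc k')) where

  r : ℕ
  r = suc n'

  colourOf : ∀ m {P : [ω]^ r → Set} → Dec (∃ λ s → Bounded m s × P s) → Fin (suc k')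
  colourOf m (yes (s , s<m , _)) = c (addMax s m s<m)
  colourOf m (no _)              = fzero

  colourOf-unique : ∀ m {P : [ω]^ r → Set} (d : Dec (∃ λ s → Bounded m s × P s))
                    s (s<m : Bounded m s) → P s → (∀ s' → Bounded m s' → P s' → elems s' ≡ elems s) → colourOf m d ≡ c (addMax s m s<m)
  colourOf-unique m (yes (s' , s'<m , Ps')) s s<m Ps unique =
    cong c (elems-injective (cong (_∷ʳ m) (unique s' s'<m Ps')))
  colourOf-unique m (no ∄) s s<m Ps _ = ⊥-elim (∄ (s , s<m , Ps))

  colour : ℕ → (ℕ → ℕ) → [ω]^ r → Fin (suc k')
  colour m h u = colourOf m (∃-bounded? m (λ s → ≡-dec _≟_ (map h (elems s)) (elems u)))

  candidates : ℕ → (ℕ → ℕ) → List ([ω]^ r)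
  candidates m h = subsetsBelow r (maxBelow m h + r)

  classes : ℕ → (ℕ → ℕ) → Fin (suc k') → List ([ω]^ r)
  classes m h = colourClass (colour m h) (candidates m h)

  classes-disjoint : ∀ m h → PairwiseDisjoint (classes m h)
  classes-disjoint m h = colourClass-disjoint (colour m h) (candidates m h)

  next : ℕ → (ℕ → ℕ) → ℕ
  next m h = proj₁ (star (classes m h) (classes-disjoint m h))

  next-avoids : ∀ m h i s → s ∈ classes m h i → ¬ (next m h ∈ elems s)
  next-avoids m h = proj₁ (proj₂ (star (classes m h) (classes-disjoint m h)))

  next-colours : ∀ m h i s → s ∈ classes m h i →
                 ∀ t → t IsInsert next m h Into s → R t ≡ i
  next-colours m h = proj₂ (proj₂ (star (classes m h) (classes-disjoint m h)))

  candidates-cover : ∀ m h u → Bounded (maxBelow m h + r) u → ∃ λ i → u ∈ classes m h i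
  candidates-cover m h u u<N = colour m h u , ∈-colourClass (colour m h) (∈-subsetsBelow {s = u} u<N)

  maxBelow<next : ∀ m h → maxBelow m h < next m h
  maxBelow<next m h = avoiding-point-exceeds (classes m h) (candidates-cover m h) (next-avoids m h)

  prefix : ℕ → ℕ → ℕ
  prefix zero    a = 0
  prefix (suc m) a with a ≟ m
  ... | yes _ = next m (prefix m)
  ... | no  _ = prefix m a

  f : ℕ → ℕ
  f m = next m (prefix m)

  prefix-agrees : ∀ {a m} → a < m → prefix m a ≡ f a
  prefix-agrees {a} {suc m} a<1+m with a ≟ m
  ... | yes refl = refl
  ... | no a≢m   = prefix-agrees (≤∧≢⇒< (≤-pred a<1+m) a≢m)

  map-prefix : ∀ {m xs} → All (_< m) xs → map (prefix m) xs ≡ map f xs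
  map-prefix []           = refl
  map-prefix (x<m ∷ xs<m) = cong₂ _∷_ (prefix-agrees x<m) (map-prefix xs<m)

  f-below : ∀ {a m} → a < m → f a ≤ maxBelow m (prefix m)
  f-below {m = m} a<m =
    subst (_≤ maxBelow m (prefix m)) (prefix-agrees a<m) (≤-maxBelow (prefix m) a<m)

  f-increasing : f Preserves _<_ ⟶ _<_
  f-increasing {_} {b} a<b = ≤-<-trans (f-below a<b) (maxBelow<next b (prefix b))

  f-injective : Injective _≡_ _≡_ f
  f-injective = <-preserving⇒injective f-increasing

  colour-image : ∀ m (s : [ω]^ r) (s<m : Bounded m s) →
                 colour m (prefix m) (image f f-increasing s) ≡ c (addMax s m s<m)
  colour-image m s s<m =
    colourOf-unique m (∃-bounded? m (λ s' → ≡-dec _≟_ (map (prefix m) (elems s')) (map f (elems s))))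
      s s<m (map-prefix s<m)
      (λ s' s'<m eq → map-injective f-injective (trans (sym (map-prefix s'<m)) eq))

  image-candidate : ∀ m (s : [ω]^ r) → Bounded m s → image f f-increasing s ∈ candidates m (prefix m)
  image-candidate m s s<m = ∈-subsetsBelow {s = image f f-increasing s}
    (All.map⁺ (All.map (λ a<m → ≤-<-trans (f-below a<m) (m<m+n _ z<s)) s<m))

  f-realises : ∀ (s t : [ω]^ (suc r)) → t IsImageOf s Under f → c s ≡ R t
  f-realises s t img with splitMax s
  ... | l , m , l<m , refl = begin
    c (addMax l m l<m)                           ≡⟨ colour-image m l l<m ⟨
    colour m (prefix m) (image f f-increasing l) ≡⟨ next-colours m (prefix m) _ _
                                                      (∈-colourClass _ (image-candidate m l l<m))
                                                      t (image-addMax f-increasing l m l<m t img) ⟨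
    R t                                          ∎
    where open ≡-Reasoning

proposition2p2 : ∀ (n k : ℕ) → 2 ≤ n → 1 ≤ k →
    (R : [ω]^ n → Fin k) → StarProperty n k R →
    (c : [ω]^ n → Fin k) →
    Σ (ℕ → ℕ) λ f → Injective _≡_ _≡_ f ×
      (∀ (s t : [ω]^ n) → t IsImageOf s Under f → c s ≡ R t)
proposition2p2 (suc (suc n')) (suc k') (s≤s (s≤s z≤n)) (s≤s z≤n) R star c =
  f , f-injective , f-realises
  where open Construction n' k' R star c
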